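{- Let $Q$ be a positive integer, let $x$ be the least common multiple of $1,2,\dots,Q$, and let $X=(X_{mn})_{m,n=1}^x$ with $X_{mn}=\sum_{q=1}^Q c_q(m-n)$. For $1\le j\le x$ let $\omega_j=\exp(2\pi i j/x)$, $x'=x/\gcd(j,x)$, and let $v_j$ be the (column) vector of length $x$ obtained by concatenating $x/x'$ copies of the block $(1,\omega_j,\omega_j^2,\dots,\omega_j^{x'-1})$. Then $Xv_j=\lambda_jv_j$, where $\lambda_j=x$ if $x'\le Q$ and $\lambda_j=0$ if $x'>Q$; these $\lambda_j$ ($1\le j\le x$) are the eigenvalues of $X$ with eigenvectors $v_j$.
   Context: For a positive integer $q$ and any integer $n$, the Ramanujan sum is $c_q(n)=\sum_{1\le k\le q,\ \gcd(k,q)=1}\exp(2\pi i kn/q)$. -}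

module Defs where

open import Level using (Level)
open import Data.Nat as ℕ using (ℕ; zero; suc; _≤_; _<_)
open import Data.Nat.DivMod using (_/_; _%_)
open import Data.Nat.GCD using (gcd)
open import Data.Nat.LCM using (lcm)
open import Data.Integer as ℤ using (ℤ; +_; -[1+_])
open import Relation.Nullary using (¬_)
open import Relation.Nullary.Decidable using (does)
open import Data.Bool using (if_then_else_)
open import Algebra.Bundles using (CommutativeRing)
open import Data.Product using (_×_; ∃)

lcmUpTo : ℕ → ℕ
lcmUpTo zero    = 1
lcmUpTo (suc n) = lcm (suc n) (lcmUpTo n)

-- natural-number division / remainder; only ever used with a nonzero divisor
divN : ℕ → ℕ → ℕ
divN m zero    = 0
divN m (suc d) = m / suc d

modN : ℕ → ℕ → ℕ
modN m zero    = m
modN m (suc d) = m % suc d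

-- Everything is set in a commutative ring R with a chosen element ω, and a
-- fixed natural number x (ω will be assumed to be a primitive x-th root of 1,
-- playing the role of exp(2πi/x)).
module Ramanujan {c ℓ : Level} (R : CommutativeRing c ℓ) (ω : CommutativeRing.Carrier R) (x : ℕ) where
  open CommutativeRing R

  pow : Carrier → ℕ → Carrier
  pow a zero    = 1#
  pow a (suc n) = a * pow a n

  nat : ℕ → Carrier
  nat zero    = 0#
  nat (suc n) = 1# + nat n

  sum1 : ℕ → (ℕ → Carrier) → Carrier
  sum1 zero    f = 0#
  sum1 (suc n) f = sum1 n f + f (suc n)

  -- ω^e for an integer e, using ω⁻¹ = ω^(x-1) (valid since ω^x = 1, x ≥ 1)
  ωpow : ℤ → Carrier
  ωpow (+ n)      = pow ω n
  ωpow -[1+ n ]   = pow (pow ω (x ℕ.∸ 1)) (suc n)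

  -- Ramanujan sum c_q(n) = Σ_{1≤k≤q, gcd(k,q)=1} exp(2πi k n / q);
  -- for q ∣ x, exp(2πi k n/q) = ω^((x/q) k n).
  ramanujan : ℕ → ℤ → Carrier
  ramanujan q n = sum1 q (λ k →
    if does (gcd k q ℕ.≟ 1)
    then ωpow (+ (divN x q ℕ.* k) ℤ.* n)
    else 0#)

  Xmat : ℕ → ℕ → ℕ → Carrier
  Xmat Q m n = sum1 Q (λ q → ramanujan q (+ m ℤ.- + n))

  Xapply : ℕ → (ℕ → Carrier) → ℕ → Carrier
  Xapply Q v m = sum1 x (λ n → Xmat Q m n * v n)

  x′ : ℕ → ℕ
  x′ j = divN x (gcd j x)

  ωj : ℕ → Carrier
  ωj j = pow ω j

  -- v_j: x/x' copies of the block (1, ω_j, ..., ω_j^(x'-1)); its n-th entry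
  -- (1 ≤ n ≤ x) is ω_j^((n-1) mod x').
  vvec : ℕ → ℕ → Carrier
  vvec j n = pow (ωj j) (modN (n ℕ.∸ 1) (x′ j))

  eigλ : ℕ → ℕ → Carrier
  eigλ Q j = if does (x′ j ℕ.≤? Q) then nat x else 0#

  IsEigenpair : ℕ → Carrier → (ℕ → Carrier) → Set ℓ
  IsEigenpair Q μ v =
    ((m : ℕ) → 1 ≤ m → m ≤ x → Xapply Q v m ≈ μ * v m)
    × ∃ (λ n → 1 ≤ n × n ≤ x × ¬ (v n ≈ 0#))

{-# OPTIONS --safe #-}
-- Grouping the Ramanujan sums, X_{mn} = Σ ω^((x/q)k(m-n)) over the fractions k/q
-- in lowest terms with q ≤ Q, and k/q ↦ j = (x/q)k identifies these fractions
-- with the j ∈ [1, x] for which x/gcd(j, x) ≤ Q. Orthogonality of the characters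
-- n ↦ ω^(jn) then gives X v_j = λ_j v_j, and dually that n ↦ ω^(-jn) is a left
-- eigenvector for λ_j. For an eigenpair (μ, v) this yields (μ - λ_j)⟨ω^(-j·), v⟩ = 0
-- for every j, and since the nodes ω^(-n) are distinct, a Vandermonde argument
-- shows that these transforms of v ≠ 0 cannot all vanish; so μ = λ_j for some j.
-- The same Vandermonde argument with the nodes ω^j gives independence of the v_j.
module Submission where

open import Defs
open import Level using (Level)
open import Data.Bool using (true; false; if_then_else_)
open import Data.Empty using (⊥-elim)
open import Data.Integer as ℤ using (ℤ; +_)
import Data.Integer.DivMod as ℤ
import Data.Integer.Properties as ℤP
open import Data.Integer.Tactic.RingSolver using (solve-∀)
open import Data.Nat as ℕ using (ℕ; zero; suc; _≤_; _<_; z≤n; s≤s)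
import Data.Nat.Properties as ℕP
open import Data.Nat.Coprimality using (coprime-/gcd; coprime⇒gcd≡1)
open import Data.Nat.Divisibility using (_∣_; ∣-trans)
open import Data.Nat.DivMod using (_/_; _%_; m≡m%n+[m/n]*n; m/n*n≡m; m*[n/m]≡n; m*n/n≡m)
open import Data.Nat.GCD using (gcd; gcd[m,n]∣m; gcd[m,n]∣n; gcd[m,n]≢0; c*gcd[m,n]≡gcd[cm,cn])
open import Data.Nat.LCM using (lcm; m∣lcm[m,n]; n∣lcm[m,n]; gcd*lcm)
open import Data.Product using (_×_; _,_; ∃)
open import Data.Sum using (_⊎_; inj₁; inj₂; [_,_])
open import Relation.Nullary using (¬_; Dec; yes; no; does)
open import Relation.Binary.Definitions using (tri<; tri≈; tri>)
open import Relation.Binary.PropositionalEquality as P using (_≡_; _≢_)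
open import Algebra.Bundles using (CommutativeRing)

lcm≡0⇒m≡0∨n≡0 : ∀ m n → lcm m n ≡ 0 → m ≡ 0 ⊎ n ≡ 0
lcm≡0⇒m≡0∨n≡0 m n lcm≡0 = ℕP.m*n≡0⇒m≡0∨n≡0 m
  (P.trans (P.sym (gcd*lcm m n)) (P.trans (P.cong (gcd m n ℕ.*_) lcm≡0) (ℕP.*-zeroʳ (gcd m n))))

lcmUpTo≢0 : ∀ Q → lcmUpTo Q ≢ 0
lcmUpTo≢0 (suc Q) lcm≡0 with lcm≡0⇒m≡0∨n≡0 (suc Q) (lcmUpTo Q) lcm≡0
... | inj₂ L≡0 = lcmUpTo≢0 Q L≡0

∣lcmUpTo : ∀ {q} Q → 1 ≤ q → q ≤ Q → q ∣ lcmUpTo Q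
∣lcmUpTo zero (s≤s _) ()
∣lcmUpTo (suc Q) 1≤q q≤1+Q with ℕP.m≤n⇒m<n∨m≡n q≤1+Q
... | inj₁ q<1+Q = ∣-trans (∣lcmUpTo Q 1≤q (ℕP.≤-pred q<1+Q)) (n∣lcm[m,n] (suc Q) (lcmUpTo Q))
... | inj₂ P.refl  = m∣lcm[m,n] (suc Q) (lcmUpTo Q)

divN≡/ : ∀ m d .{{_ : ℕ.NonZero d}} → divN m d ≡ m / d
divN≡/ m (suc d) = P.refl

divN-*ˡ : ∀ d m .{{_ : ℕ.NonZero d}} → divN (d ℕ.* m) d ≡ m
divN-*ˡ d m = P.trans (divN≡/ (d ℕ.* m) d) (P.trans (P.cong (_/ d) (ℕP.*-comm d m)) (m*n/n≡m m d))

%ℕ-congruent : ∀ z r s d .{{_ : ℕ.NonZero d}} → z ≡ + r ℤ.+ + d ℤ.* s →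
               + (z ℤ.%ℕ d) ≡ + r ℤ.+ + d ℤ.* (s ℤ.- z ℤ./ℕ d)
%ℕ-congruent z r s d z≡r+ds = begin
  + (z ℤ.%ℕ d)                               ≡⟨ unshift (+ (z ℤ.%ℕ d)) (z ℤ./ℕ d) (+ d) ⟩
  (+ (z ℤ.%ℕ d) ℤ.+ z ℤ./ℕ d ℤ.* + d) ℤ.- z ℤ./ℕ d ℤ.* + d
                                             ≡⟨ P.cong (ℤ._- z ℤ./ℕ d ℤ.* + d) (P.sym (ℤ.a≡a%ℕn+[a/ℕn]*n z d)) ⟩
  z ℤ.- z ℤ./ℕ d ℤ.* + d                     ≡⟨ P.cong (ℤ._- z ℤ./ℕ d ℤ.* + d) z≡r+ds ⟩
  (+ r ℤ.+ + d ℤ.* s) ℤ.- z ℤ./ℕ d ℤ.* + d   ≡⟨ regroup (+ r) (+ d) s (z ℤ./ℕ d) ⟩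
  + r ℤ.+ + d ℤ.* (s ℤ.- z ℤ./ℕ d)           ∎
  where
    open P.≡-Reasoning
    unshift : ∀ a q D → a ≡ (a ℤ.+ q ℤ.* D) ℤ.- q ℤ.* D
    unshift = solve-∀
    regroup : ∀ r D s q → (r ℤ.+ D ℤ.* s) ℤ.- q ℤ.* D ≡ r ℤ.+ D ℤ.* (s ℤ.- q)
    regroup = solve-∀

m[n/gcd]≡n[m/gcd] : ∀ m n .{{_ : ℕ.NonZero (gcd m n)}} → m ℕ.* (n / gcd m n) ≡ n ℕ.* (m / gcd m n)
m[n/gcd]≡n[m/gcd] m n = begin
  m ℕ.* (n / g)                ≡⟨ P.cong (ℕ._* (n / g)) (P.sym (m/n*n≡m (gcd[m,n]∣m m n))) ⟩
  (m / g) ℕ.* g ℕ.* (n / g)    ≡⟨ ℕP.*-assoc (m / g) g (n / g) ⟩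
  (m / g) ℕ.* (g ℕ.* (n / g))  ≡⟨ P.cong ((m / g) ℕ.*_) (m*[n/m]≡n (gcd[m,n]∣n m n)) ⟩
  (m / g) ℕ.* n                ≡⟨ ℕP.*-comm (m / g) n ⟩
  n ℕ.* (m / g)                ∎
  where
    open P.≡-Reasoning
    g = gcd m n

some-or-all : ∀ {p q} {A : ℕ → Set p} {B : ℕ → Set q} N →
  (∀ j → 1 ≤ j → j ≤ N → A j ⊎ B j) →
  (∃ λ j → 1 ≤ j × j ≤ N × A j) ⊎ (∀ j → 1 ≤ j → j ≤ N → B j)
some-or-all zero    A⊎B = inj₂ (λ { _ (s≤s _) () })
some-or-all (suc N) A⊎B with some-or-all N (λ j 1≤j j≤N → A⊎B j 1≤j (ℕP.m≤n⇒m≤1+n j≤N))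
... | inj₁ (j , 1≤j , j≤N , Aj) = inj₁ (j , 1≤j , ℕP.m≤n⇒m≤1+n j≤N , Aj)
... | inj₂ B≤N with A⊎B (suc N) (s≤s z≤n) ℕP.≤-refl
...   | inj₁ A[1+N] = inj₁ (suc N , s≤s z≤n , ℕP.≤-refl , A[1+N])
...   | inj₂ B[1+N] = inj₂ λ j 1≤j j≤1+N →
  [ (λ j<1+N → B≤N j 1≤j (ℕP.≤-pred j<1+N)) , (λ { P.refl → B[1+N] }) ] (ℕP.m≤n⇒m<n∨m≡n j≤1+N)

-- j / x = num j / den j in lowest terms, and every fraction k / q in lowest
-- terms with q ∣ x arises this way from j = (x / q) k.
module ReducedFractions (x : ℕ) .{{_ : ℕ.NonZero x}} where

  den num : ℕ → ℕ
  den j = divN x (gcd j x)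
  num j = divN j (gcd j x)

  1≤x/q : ∀ {q} .{{_ : ℕ.NonZero q}} → q ∣ x → 1 ≤ x / q
  1≤x/q {q} q∣x = ℕP.n≢0⇒n>0 (λ x/q≡0 →
    ℕ.≢-nonZero⁻¹ x (P.trans (P.sym (m/n*n≡m q∣x)) (P.cong (ℕ._* q) x/q≡0)))

  reduced-unique : ∀ {q k j} → 1 ≤ q → q ∣ x → gcd k q ≡ 1 → divN x q ℕ.* k ≡ j →
                   q ≡ den j × k ≡ num j
  reduced-unique {q} {k} 1≤q q∣x gcd≡1 P.refl =
    P.sym (P.trans (P.cong₂ divN (P.sym dq≡x) gcd≡d) (divN-*ˡ d q)) ,
    P.sym (P.trans (P.cong₂ divN [x/q]k≡dk gcd≡d) (divN-*ˡ d k))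
    where
      instance
        _ : ℕ.NonZero q
        _ = ℕ.>-nonZero 1≤q
      d = x / q
      dq≡x : d ℕ.* q ≡ x
      dq≡x = m/n*n≡m q∣x
      instance
        _ : ℕ.NonZero d
        _ = ℕ.>-nonZero (1≤x/q q∣x)
      [x/q]k≡dk : divN x q ℕ.* k ≡ d ℕ.* k
      [x/q]k≡dk = P.cong (ℕ._* k) (divN≡/ x q)
      gcd≡d : gcd (divN x q ℕ.* k) x ≡ d
      gcd≡d = begin
        gcd (divN x q ℕ.* k) x      ≡⟨ P.cong₂ gcd [x/q]k≡dk (P.sym dq≡x) ⟩
        gcd (d ℕ.* k) (d ℕ.* q)     ≡⟨ P.sym (c*gcd[m,n]≡gcd[cm,cn] d k q) ⟩
        d ℕ.* gcd k q               ≡⟨ P.cong (d ℕ.*_) gcd≡1 ⟩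
        d ℕ.* 1                     ≡⟨ ℕP.*-identityʳ d ⟩
        d                           ∎
        where open P.≡-Reasoning

  record ReducedForm (j : ℕ) : Set where
    field
      1≤den   : 1 ≤ den j
      1≤num   : 1 ≤ num j
      num≤den : num j ≤ den j
      coprime : gcd (num j) (den j) ≡ 1
      divN-*  : divN x (den j) ℕ.* num j ≡ j

  reduced-form : ∀ {j} → 1 ≤ j → j ≤ x → ReducedForm j
  reduced-form {j} 1≤j j≤x = record
    { 1≤den   = 1≤den
    ; 1≤num   = ℕP.n≢0⇒n>0 (λ num≡0 → ℕP.<⇒≢ 1≤j (P.sym (P.trans j≡num*g (P.cong (ℕ._* g) num≡0))))
    ; num≤den = ℕP.*-cancelʳ-≤ (num j) (den j) g (P.subst₂ _≤_ j≡num*g x≡den*g j≤x)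
    ; coprime = P.subst₂ (λ a b → gcd a b ≡ 1) (P.sym (divN≡/ j g)) (P.sym (divN≡/ x g))
                       (coprime⇒gcd≡1 (coprime-/gcd j x))
    ; divN-*  = begin
        divN x (den j) ℕ.* num j             ≡⟨ P.cong (λ t → divN t (den j) ℕ.* num j) x≡den*g ⟩
        divN (den j ℕ.* g) (den j) ℕ.* num j ≡⟨ P.cong (ℕ._* num j) (divN-*ˡ (den j) g) ⟩
        g ℕ.* num j                          ≡⟨ P.cong (g ℕ.*_) (divN≡/ j g) ⟩
        g ℕ.* (j / g)                        ≡⟨ m*[n/m]≡n (gcd[m,n]∣m j x) ⟩
        j                                    ∎
    }
    where
      open P.≡-Reasoning
      g = gcd j x
      instance
        _ : ℕ.NonZero g
        _ = ℕ.≢-nonZero (gcd[m,n]≢0 j x (inj₂ (ℕ.≢-nonZero⁻¹ x)))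
      x≡den*g : x ≡ den j ℕ.* g
      x≡den*g = P.trans (P.sym (m/n*n≡m (gcd[m,n]∣n j x))) (P.cong (ℕ._* g) (P.sym (divN≡/ x g)))
      j≡num*g : j ≡ num j ℕ.* g
      j≡num*g = P.trans (P.sym (m/n*n≡m (gcd[m,n]∣m j x))) (P.cong (ℕ._* g) (P.sym (divN≡/ j g)))
      1≤den : 1 ≤ den j
      1≤den = ℕP.n≢0⇒n>0 (λ den≡0 → ℕ.≢-nonZero⁻¹ x (P.trans x≡den*g (P.cong (ℕ._* g) den≡0)))
      instance
        _ : ℕ.NonZero (den j)
        _ = ℕ.>-nonZero 1≤den

  divN-*-bounds : ∀ {q k} → 1 ≤ q → q ∣ x → 1 ≤ k → k ≤ q → 1 ≤ divN x q ℕ.* k × divN x q ℕ.* k ≤ x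
  divN-*-bounds {q} {k} 1≤q q∣x 1≤k k≤q = P.subst (λ a → 1 ≤ a × a ≤ x) (P.cong (ℕ._* k) (P.sym (divN≡/ x q)))
    (ℕP.*-mono-≤ (1≤x/q q∣x) 1≤k , ℕP.≤-trans (ℕP.*-monoʳ-≤ (x / q) k≤q) (ℕP.≤-reflexive (m/n*n≡m q∣x)))
    where
      instance
        _ : ℕ.NonZero q
        _ = ℕ.>-nonZero 1≤q

-- sum1, pow and nat live in the parameterised module Ramanujan, so these
-- general facts carry its parameters ω and x without using them.
module SumsAndPowers {c ℓ : Level} (R : CommutativeRing c ℓ) (ω : CommutativeRing.Carrier R) (x : ℕ) where
  open CommutativeRing R
  open Ramanujan R ω x
  open import Algebra.Properties.Ring ring
    using (-0#≈0#; -‿+-comm; +-cancelʳ; +-inverseˡ-unique; x∙y⁻¹≈ε⇒x≈y; x≈y⇒x∙y⁻¹≈ε;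
           -‿distribʳ-*; [y-z]x≈yx-zx; x[y-z]≈xy-xz)
  open import Algebra.Properties.CommutativeSemigroup *-commutativeSemigroup using (x∙yz≈y∙xz)
  open import Algebra.Properties.CommutativeSemigroup +-commutativeSemigroup using (interchange)
  open import Relation.Binary.Reasoning.Setoid setoid

  sum1-cong : ∀ N {f g : ℕ → Carrier} → (∀ k → k < N → f (suc k) ≈ g (suc k)) → sum1 N f ≈ sum1 N g
  sum1-cong zero    f≈g = refl
  sum1-cong (suc N) f≈g = +-cong (sum1-cong N (λ k k<N → f≈g k (ℕP.m<n⇒m<1+n k<N))) (f≈g N ℕP.≤-refl)

  sum1-const : ∀ N a → sum1 N (λ _ → a) ≈ nat N * a
  sum1-const zero    a = sym (zeroˡ a)
  sum1-const (suc N) a = begin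
    sum1 N (λ _ → a) + a   ≈⟨ +-cong (sum1-const N a) (sym (*-identityˡ a)) ⟩
    nat N * a + 1# * a     ≈⟨ sym (distribʳ a _ _) ⟩
    (nat N + 1#) * a       ≈⟨ *-congʳ (+-comm _ 1#) ⟩
    nat (suc N) * a        ∎

  sum1≈0# : ∀ N {f : ℕ → Carrier} → (∀ k → k < N → f (suc k) ≈ 0#) → sum1 N f ≈ 0#
  sum1≈0# N f≈0 = trans (sum1-cong N f≈0) (trans (sum1-const N 0#) (zeroʳ (nat N)))

  sum1-+ : ∀ N (f g : ℕ → Carrier) → sum1 N (λ k → f k + g k) ≈ sum1 N f + sum1 N g
  sum1-+ zero    f g = sym (+-identityˡ 0#)
  sum1-+ (suc N) f g = trans (+-congʳ (sum1-+ N f g)) (interchange _ _ _ _)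

  sum1-*ˡ : ∀ N a (f : ℕ → Carrier) → a * sum1 N f ≈ sum1 N (λ k → a * f k)
  sum1-*ˡ zero    a f = zeroʳ a
  sum1-*ˡ (suc N) a f = trans (distribˡ a _ _) (+-congʳ (sum1-*ˡ N a f))

  sum1-*ʳ : ∀ N a (f : ℕ → Carrier) → sum1 N f * a ≈ sum1 N (λ k → f k * a)
  sum1-*ʳ zero    a f = zeroˡ a
  sum1-*ʳ (suc N) a f = trans (distribʳ a _ _) (+-congʳ (sum1-*ʳ N a f))

  sum1-swap : ∀ N M (f : ℕ → ℕ → Carrier) →
              sum1 N (λ n → sum1 M (f n)) ≈ sum1 M (λ m → sum1 N (λ n → f n m))
  sum1-swap zero    M f = sym (sum1≈0# M (λ _ _ → refl))
  sum1-swap (suc N) M f = trans (+-congʳ (sum1-swap N M f)) (sym (sum1-+ M _ _))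

  sum1-single : ∀ N p (f : ℕ → Carrier) → 1 ≤ p → p ≤ N →
                (∀ k → k < N → suc k ≢ p → f (suc k) ≈ 0#) → sum1 N f ≈ f p
  sum1-single zero    _ f (s≤s _) ()
  sum1-single (suc N) p f 1≤p p≤1+N f≈0 with p ℕP.≟ suc N
  ... | yes P.refl = trans (+-congʳ (sum1≈0# N (λ k k<N → f≈0 k (ℕP.m<n⇒m<1+n k<N) (ℕP.<⇒≢ (s≤s k<N)))))
                         (+-identityˡ _)
  ... | no p≢1+N = trans (+-cong (sum1-single N p f 1≤p (ℕP.≤-pred (ℕP.≤∧≢⇒< p≤1+N p≢1+N))
                                                (λ k k<N → f≈0 k (ℕP.m<n⇒m<1+n k<N)))
                                 (f≈0 N ℕP.≤-refl (λ 1+N≡p → p≢1+N (P.sym 1+N≡p))))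
                         (+-identityʳ _)

  sum1-neg : ∀ N (f : ℕ → Carrier) → sum1 N (λ k → - f k) ≈ - sum1 N f
  sum1-neg zero    f = sym -0#≈0#
  sum1-neg (suc N) f = trans (+-congʳ (sum1-neg N f)) (-‿+-comm _ _)

  sum1-- : ∀ N (f g : ℕ → Carrier) → sum1 N (λ k → f k - g k) ≈ sum1 N f - sum1 N g
  sum1-- N f g = trans (sum1-+ N f (λ k → - g k)) (+-congˡ (sum1-neg N g))

  pow-cong : ∀ {a b} n → a ≈ b → pow a n ≈ pow b n
  pow-cong zero    a≈b = refl
  pow-cong (suc n) a≈b = *-cong a≈b (pow-cong n a≈b)

  pow-+ : ∀ a m n → pow a (m ℕ.+ n) ≈ pow a m * pow a n
  pow-+ a zero    n = sym (*-identityˡ _)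
  pow-+ a (suc m) n = trans (*-congˡ (pow-+ a m n)) (sym (*-assoc _ _ _))

  pow-1# : ∀ n → pow 1# n ≈ 1#
  pow-1# zero    = refl
  pow-1# (suc n) = trans (*-identityˡ _) (pow-1# n)

  pow-* : ∀ a m n → pow a (m ℕ.* n) ≈ pow (pow a m) n
  pow-* a m zero    = reflexive (P.cong (pow a) (ℕP.*-zeroʳ m))
  pow-* a m (suc n) = begin
    pow a (m ℕ.* suc n)          ≡⟨ P.cong (pow a) (ℕP.*-suc m n) ⟩
    pow a (m ℕ.+ m ℕ.* n)        ≈⟨ pow-+ a m (m ℕ.* n) ⟩
    pow a m * pow a (m ℕ.* n)    ≈⟨ *-congˡ (pow-* a m n) ⟩
    pow a m * pow (pow a m) n    ∎

  pow-*≈1# : ∀ a m n → pow a m ≈ 1# → pow a (m ℕ.* n) ≈ 1#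
  pow-*≈1# a m n aᵐ≈1 = trans (pow-* a m n) (trans (pow-cong n aᵐ≈1) (pow-1# n))

  pow-modN : ∀ a p r → pow a p ≈ 1# → pow a (modN r p) ≈ pow a r
  pow-modN a zero    r aᵖ≈1 = refl
  pow-modN a (suc p) r aᵖ≈1 = sym (begin
    pow a r                                  ≡⟨ P.cong (pow a) (m≡m%n+[m/n]*n r (suc p)) ⟩
    pow a (r % suc p ℕ.+ (r / suc p) ℕ.* suc p)
                                             ≡⟨ P.cong (λ e → pow a (r % suc p ℕ.+ e)) (ℕP.*-comm (r / suc p) (suc p)) ⟩
    pow a (r % suc p ℕ.+ suc p ℕ.* (r / suc p))
                                             ≈⟨ pow-+ a (r % suc p) _ ⟩
    pow a (r % suc p) * pow a (suc p ℕ.* (r / suc p))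
                                             ≈⟨ *-congˡ (pow-*≈1# a (suc p) (r / suc p) aᵖ≈1) ⟩
    pow a (r % suc p) * 1#                   ≈⟨ *-identityʳ _ ⟩
    pow a (r % suc p)                        ∎)

  if-does : ∀ {p} {A : Set p} (A? : Dec A) {u v w} → (A → u ≈ w) → (¬ A → v ≈ w) →
            (if does A? then u else v) ≈ w
  if-does (yes a) u≈w v≈w = u≈w a
  if-does (no ¬a) u≈w v≈w = v≈w ¬a

  if-cong : ∀ b {u v} → u ≈ v → (if b then u else 0#) ≈ (if b then v else 0#)
  if-cong true  u≈v = u≈v
  if-cong false u≈v = refl

  if-*ʳ : ∀ b u w → (if b then u else 0#) * w ≈ (if b then u * w else 0#)
  if-*ʳ true  u w = refl
  if-*ʳ false u w = zeroˡ w

  *-if : ∀ b u w → w * (if b then u else 0#) ≈ (if b then w * u else 0#)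
  *-if true  u w = refl
  *-if false u w = zeroʳ w

  sum1-if : ∀ N b (f : ℕ → Carrier) → sum1 N (λ n → if b then f n else 0#) ≈ (if b then sum1 N f else 0#)
  sum1-if N true  f = refl
  sum1-if N false f = sum1≈0# N (λ _ _ → refl)

  δ : ℕ → ℕ → Carrier → Carrier
  δ a j u = if does (a ℕ.≟ j) then u else 0#

  δ-on : ∀ {a j u} → a ≡ j → δ a j u ≈ u
  δ-on {a} {j} a≡j = if-does (a ℕ.≟ j) (λ _ → refl) (λ a≢j → ⊥-elim (a≢j a≡j))

  δ-off : ∀ {a j u} → a ≢ j → δ a j u ≈ 0#
  δ-off {a} {j} a≢j = if-does (a ℕ.≟ j) (λ a≡j → ⊥-elim (a≢j a≡j)) (λ _ → refl)

  δ-cong : ∀ a j {u v} → (a ≡ j → u ≈ v) → δ a j u ≈ δ a j v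
  δ-cong a j u≈v with a ℕ.≟ j
  ... | yes P.refl = trans (δ-on {a} {a} P.refl) (trans (u≈v P.refl) (sym (δ-on {a} {a} P.refl)))
  ... | no a≢j     = trans (δ-off a≢j) (sym (δ-off a≢j))

  δ-sym : ∀ a j {u} → δ j a u ≈ δ a j u
  δ-sym a j with a ℕ.≟ j
  ... | yes P.refl = refl
  ... | no a≢j     = trans (δ-off (λ j≡a → a≢j (P.sym j≡a))) (sym (δ-off a≢j))

  -- Summation over the fractions k / q in lowest terms with 1 ≤ k ≤ q ≤ Q,
  -- the index set of X = Σ_{q ≤ Q} c_q.
  Σ-reduced : ℕ → (ℕ → ℕ → Carrier) → Carrier
  Σ-reduced Q G = sum1 Q (λ q → sum1 q (λ k → if does (gcd k q ℕ.≟ 1) then G q k else 0#))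

  Σ-reduced-cong : ∀ Q {G H : ℕ → ℕ → Carrier} →
    (∀ q k → 1 ≤ q → q ≤ Q → 1 ≤ k → k ≤ q → G q k ≈ H q k) → Σ-reduced Q G ≈ Σ-reduced Q H
  Σ-reduced-cong Q G≈H = sum1-cong Q (λ q q<Q → sum1-cong (suc q) (λ k k≤q →
    if-cong (does (gcd (suc k) (suc q) ℕ.≟ 1)) (G≈H (suc q) (suc k) (s≤s z≤n) q<Q (s≤s z≤n) k≤q)))

  *-Σ-reduced : ∀ Q a (G : ℕ → ℕ → Carrier) → a * Σ-reduced Q G ≈ Σ-reduced Q (λ q k → a * G q k)
  *-Σ-reduced Q a G = trans (sum1-*ˡ Q a _) (sum1-cong Q (λ q _ → trans (sum1-*ˡ (suc q) a _)
    (sum1-cong (suc q) (λ k _ → *-if (does (gcd (suc k) (suc q) ℕ.≟ 1)) _ a))))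

  Σ-reduced-* : ∀ Q a (G : ℕ → ℕ → Carrier) → Σ-reduced Q G * a ≈ Σ-reduced Q (λ q k → G q k * a)
  Σ-reduced-* Q a G = trans (*-comm _ a) (trans (*-Σ-reduced Q a G)
    (Σ-reduced-cong Q (λ _ _ _ _ _ _ → *-comm a _)))

  sum1-Σ-reduced : ∀ N Q (G : ℕ → ℕ → ℕ → Carrier) →
    sum1 N (λ n → Σ-reduced Q (G n)) ≈ Σ-reduced Q (λ q k → sum1 N (λ n → G n q k))
  sum1-Σ-reduced N Q G = trans (sum1-swap N Q _) (sum1-cong Q (λ q _ → trans (sum1-swap N (suc q) _)
    (sum1-cong (suc q) (λ k _ → sum1-if N (does (gcd (suc k) (suc q) ℕ.≟ 1)) _))))

  sum1-pow-shift : ∀ u N → sum1 N (λ n → u * pow u n) + u ≈ sum1 N (pow u) + u * pow u N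
  sum1-pow-shift u zero    = +-congˡ (sym (*-identityʳ u))
  sum1-pow-shift u (suc N) = begin
    (sum1 N (λ n → u * pow u n) + B) + u   ≈⟨ +-assoc _ _ _ ⟩
    sum1 N (λ n → u * pow u n) + (B + u)   ≈⟨ +-congˡ (+-comm B u) ⟩
    sum1 N (λ n → u * pow u n) + (u + B)   ≈⟨ sym (+-assoc _ _ _) ⟩
    (sum1 N (λ n → u * pow u n) + u) + B   ≈⟨ +-congʳ (sum1-pow-shift u N) ⟩
    (sum1 N (pow u) + u * pow u N) + B     ∎
    where B = u * pow u (suc N)

  sum1-pow-fixed : ∀ u N → pow u N ≈ 1# → u * sum1 N (pow u) ≈ sum1 N (pow u)
  sum1-pow-fixed u N uᴺ≈1 = trans (sum1-*ˡ N u (pow u)) (+-cancelʳ u _ _ (begin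
    sum1 N (λ n → u * pow u n) + u  ≈⟨ sum1-pow-shift u N ⟩
    sum1 N (pow u) + u * pow u N    ≈⟨ +-congˡ (trans (*-congˡ uᴺ≈1) (*-identityʳ u)) ⟩
    sum1 N (pow u) + u              ∎))

  module IntegralDomain (zero-product : ∀ a b → a * b ≈ 0# → a ≈ 0# ⊎ b ≈ 0#) where

    *-cancelʳ-⊎ : ∀ a b s → a * s ≈ b * s → a ≈ b ⊎ s ≈ 0#
    *-cancelʳ-⊎ a b s as≈bs with zero-product (a - b) s (trans ([y-z]x≈yx-zx s a b) (x≈y⇒x∙y⁻¹≈ε as≈bs))
    ... | inj₁ a-b≈0 = inj₁ (x∙y⁻¹≈ε⇒x≈y a b a-b≈0)
    ... | inj₂ s≈0   = inj₂ s≈0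

    -- u (u + ⋯ + uᴺ) = u + ⋯ + uᴺ when uᴺ = 1, so u ≠ 1 forces the sum to vanish.
    sum1-pow≈0# : ∀ u N → pow u N ≈ 1# → ¬ (u ≈ 1#) → sum1 N (pow u) ≈ 0#
    sum1-pow≈0# u N uᴺ≈1 u≉1
      with *-cancelʳ-⊎ u 1# (sum1 N (pow u)) (trans (sum1-pow-fixed u N uᴺ≈1) (sym (*-identityˡ _)))
    ... | inj₁ u≈1 = ⊥-elim (u≉1 u≈1)
    ... | inj₂ S≈0 = S≈0

    power-sums-deflate : ∀ N (a c : ℕ → Carrier) i →
      sum1 (suc N) (λ t → a t * pow (c t) (suc i)) ≈ 0# → sum1 (suc N) (λ t → a t * pow (c t) i) ≈ 0# →
      sum1 N (λ t → (a t * (c t - c (suc N))) * pow (c t) i) ≈ 0#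
    power-sums-deflate N a c i sᵢ₊₁≈0 sᵢ≈0 = begin
      sum1 N (λ t → (a t * (c t - C)) * pow (c t) i)          ≈⟨ sum1-cong N (λ t _ → pointwise (suc t)) ⟩
      sum1 N (λ t → a t * pow (c t) (suc i) - C * s t i)      ≈⟨ sum1-- N _ _ ⟩
      S (suc i) - sum1 N (λ t → C * s t i)                    ≈⟨ +-congˡ (-‿cong (sym (sum1-*ˡ N C _))) ⟩
      S (suc i) - C * S i                                     ≈⟨ x≈y⇒x∙y⁻¹≈ε (begin
        S (suc i)                  ≈⟨ +-inverseˡ-unique _ _ sᵢ₊₁≈0 ⟩
        - (A * (C * pow C i))      ≈⟨ -‿cong (x∙yz≈y∙xz A C _) ⟩
        - (C * (A * pow C i))      ≈⟨ -‿distribʳ-* C _ ⟩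
        C * - (A * pow C i)        ≈⟨ *-congˡ (sym (+-inverseˡ-unique _ _ sᵢ≈0)) ⟩
        C * S i                    ∎) ⟩
      0#                                                      ∎
      where
        A = a (suc N)
        C = c (suc N)
        s : ℕ → ℕ → Carrier
        s t i = a t * pow (c t) i
        S : ℕ → Carrier
        S i = sum1 N (λ t → s t i)
        pointwise : ∀ t → (a t * (c t - C)) * pow (c t) i ≈ s t (suc i) - C * s t i
        pointwise t = begin
          (a t * (c t - C)) * pow (c t) i                       ≈⟨ *-assoc _ _ _ ⟩
          a t * ((c t - C) * pow (c t) i)                       ≈⟨ *-congˡ ([y-z]x≈yx-zx _ _ _) ⟩
          a t * (c t * pow (c t) i - C * pow (c t) i)           ≈⟨ x[y-z]≈xy-xz _ _ _ ⟩
          a t * pow (c t) (suc i) - a t * (C * pow (c t) i)     ≈⟨ +-congˡ (-‿cong (x∙yz≈y∙xz _ _ _)) ⟩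
          s t (suc i) - C * s t i                               ∎

    -- Induction on N: the coefficients aₜ (cₜ - c_{N+1}) of the first N nodes
    -- again have vanishing power sums, so they vanish, and distinctness gives aₜ = 0.
    vandermonde : ∀ N M (a c : ℕ → Carrier) → N ≤ M →
      (∀ t s → 1 ≤ t → t ≤ N → 1 ≤ s → s ≤ N → t ≢ s → ¬ (c t ≈ c s)) →
      (∀ i → i < M → sum1 N (λ t → a t * pow (c t) i) ≈ 0#) →
      ∀ t → 1 ≤ t → t ≤ N → a t ≈ 0#
    vandermonde zero    M       a c _         distinct sums≈0 _ (s≤s _) ()
    vandermonde (suc N) (suc M) a c (s≤s N≤M) distinct sums≈0 = coefficients≈0
      where
        C = c (suc N)
        lower : ∀ t → 1 ≤ t → t ≤ N → a t ≈ 0#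
        lower t 1≤t t≤N with zero-product (a t) (c t - C) (vandermonde N M (λ t → a t * (c t - C)) c N≤M
          (λ t s 1≤t t≤N 1≤s s≤N → distinct t s 1≤t (ℕP.m≤n⇒m≤1+n t≤N) 1≤s (ℕP.m≤n⇒m≤1+n s≤N))
          (λ i i<M → power-sums-deflate N a c i (sums≈0 (suc i) (s≤s i<M)) (sums≈0 i (ℕP.m<n⇒m<1+n i<M)))
          t 1≤t t≤N)
        ... | inj₁ aₜ≈0    = aₜ≈0
        ... | inj₂ cₜ-C≈0 = ⊥-elim (distinct t (suc N) 1≤t (ℕP.m≤n⇒m≤1+n t≤N) (s≤s z≤n) ℕP.≤-refl
                              (ℕP.<⇒≢ (s≤s t≤N)) (x∙y⁻¹≈ε⇒x≈y _ _ cₜ-C≈0))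
        top : a (suc N) ≈ 0#
        top = begin
          a (suc N)                                ≈⟨ sym (*-identityʳ _) ⟩
          a (suc N) * 1#                           ≈⟨ sym (+-identityˡ _) ⟩
          0# + a (suc N) * 1#                      ≈⟨ +-congʳ (sym (sum1≈0# N (λ t t<N →
                                                        trans (*-congʳ (lower (suc t) (s≤s z≤n) t<N)) (zeroˡ _)))) ⟩
          sum1 (suc N) (λ t → a t * pow (c t) 0)   ≈⟨ sums≈0 0 (s≤s z≤n) ⟩
          0#                                       ∎
        coefficients≈0 : ∀ t → 1 ≤ t → t ≤ suc N → a t ≈ 0#
        coefficients≈0 t 1≤t t≤1+N with ℕP.m≤n⇒m<n∨m≡n t≤1+N
        ... | inj₁ t<1+N  = lower t 1≤t (ℕP.≤-pred t<1+N)
        ... | inj₂ P.refl = top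

module RootOfUnity {c ℓ : Level} (R : CommutativeRing c ℓ) (ω : CommutativeRing.Carrier R) (x : ℕ)
  .{{_ : ℕ.NonZero x}} (ωˣ≈1 : CommutativeRing._≈_ R (Ramanujan.pow R ω x ω x) (CommutativeRing.1# R)) where
  open CommutativeRing R
  open Ramanujan R ω x
  open SumsAndPowers R ω x
  open import Relation.Binary.Reasoning.Setoid setoid

  pow-ω-periodic : ∀ r t → pow ω (r ℕ.+ x ℕ.* t) ≈ pow ω r
  pow-ω-periodic r t = trans (pow-+ ω r _) (trans (*-congˡ (pow-*≈1# ω x t ωˣ≈1)) (*-identityʳ _))

  pow-ω-congruent : ∀ r r' s → + r ≡ + r' ℤ.+ + x ℤ.* s → pow ω r ≈ pow ω r'
  pow-ω-congruent r r' (+ t)    r≡r'+xt = trans (reflexive (P.cong (pow ω) (ℕ-form r≡r'+xt))) (pow-ω-periodic r' t)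
    where
      ℕ-form : ∀ {r r' t} → + r ≡ + r' ℤ.+ + x ℤ.* + t → r ≡ r' ℕ.+ x ℕ.* t
      ℕ-form {r} {r'} {t} e = ℤP.+-injective
        (P.trans e (P.sym (P.trans (ℤP.pos-+ r' (x ℕ.* t)) (P.cong (λ u → + r' ℤ.+ u) (ℤP.pos-* x t)))))
  pow-ω-congruent r r' ℤ.-[1+ t ] r≡r'-x[1+t] = sym (pow-ω-congruent r' r (+ suc t) (P.trans
    (shift-back (+ r') (+ x) ℤ.-[1+ t ]) (P.cong (λ r → r ℤ.+ + x ℤ.* + suc t) (P.sym r≡r'-x[1+t]))))
    where
      shift-back : ∀ b X s → b ≡ (b ℤ.+ X ℤ.* s) ℤ.+ X ℤ.* (ℤ.- s)
      shift-back = solve-∀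

  ω^_ : ℤ → Carrier
  ω^ z = pow ω (z ℤ.%ℕ x)

  ω^-≡ : ∀ {z w} → z ≡ w → ω^ z ≈ ω^ w
  ω^-≡ z≡w = reflexive (P.cong ω^_ z≡w)

  ω^-reduce : ∀ z r s → z ≡ + r ℤ.+ + x ℤ.* s → ω^ z ≈ pow ω r
  ω^-reduce z r s z≡r+xs = pow-ω-congruent (z ℤ.%ℕ x) r (s ℤ.- z ℤ./ℕ x) (%ℕ-congruent z r s x z≡r+xs)

  ω^-pos : ∀ n → ω^ (+ n) ≈ pow ω n
  ω^-pos n = ω^-reduce (+ n) n (+ 0) (add-zero (+ n) (+ x))
    where
      add-zero : ∀ a X → a ≡ a ℤ.+ X ℤ.* + 0
      add-zero = solve-∀

  ω^-+ : ∀ a b → ω^ (a ℤ.+ b) ≈ ω^ a * ω^ b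
  ω^-+ a b = trans (ω^-reduce (a ℤ.+ b) (a ℤ.%ℕ x ℕ.+ b ℤ.%ℕ x) (a ℤ./ℕ x ℤ.+ b ℤ./ℕ x) a+b≡)
                   (pow-+ ω (a ℤ.%ℕ x) (b ℤ.%ℕ x))
    where
      regroup : ∀ A B p q X → (A ℤ.+ p ℤ.* X) ℤ.+ (B ℤ.+ q ℤ.* X) ≡ (A ℤ.+ B) ℤ.+ X ℤ.* (p ℤ.+ q)
      regroup = solve-∀
      a+b≡ : a ℤ.+ b ≡ + (a ℤ.%ℕ x ℕ.+ b ℤ.%ℕ x) ℤ.+ + x ℤ.* (a ℤ./ℕ x ℤ.+ b ℤ./ℕ x)
      a+b≡ = P.trans (P.cong₂ ℤ._+_ (ℤ.a≡a%ℕn+[a/ℕn]*n a x) (ℤ.a≡a%ℕn+[a/ℕn]*n b x))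
        (P.trans (regroup (+ (a ℤ.%ℕ x)) (+ (b ℤ.%ℕ x)) (a ℤ./ℕ x) (b ℤ./ℕ x) (+ x))
          (P.cong (λ r → r ℤ.+ + x ℤ.* (a ℤ./ℕ x ℤ.+ b ℤ./ℕ x)) (P.sym (ℤP.pos-+ (a ℤ.%ℕ x) (b ℤ.%ℕ x)))))

  pow-ω^ : ∀ z n → pow (ω^ z) n ≈ ω^ (z ℤ.* + n)
  pow-ω^ z zero    = sym (trans (ω^-≡ (ℤP.*-zeroʳ z)) (ω^-pos 0))
  pow-ω^ z (suc n) = begin
    ω^ z * pow (ω^ z) n          ≈⟨ *-congˡ (pow-ω^ z n) ⟩
    ω^ z * ω^ (z ℤ.* + n)        ≈⟨ sym (ω^-+ z _) ⟩
    ω^ (z ℤ.+ z ℤ.* + n)         ≈⟨ ω^-≡ (P.trans (mul-suc z (+ n)) (P.cong (z ℤ.*_) (P.sym (ℤP.pos-+ 1 n)))) ⟩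
    ω^ (z ℤ.* + suc n)           ∎
    where
      mul-suc : ∀ a b → a ℤ.+ a ℤ.* b ≡ a ℤ.* (+ 1 ℤ.+ b)
      mul-suc = solve-∀

  pow-ω^-x : ∀ z → pow (ω^ z) x ≈ 1#
  pow-ω^-x z = trans (pow-ω^ z x) (ω^-reduce (z ℤ.* + x) 0 z (comm (+ x) z))
    where
      comm : ∀ X z → z ℤ.* X ≡ + 0 ℤ.+ X ℤ.* z
      comm = solve-∀

  ω^-≈⇒ω^[-]≈1 : ∀ a b → ω^ a ≈ ω^ b → ω^ (a ℤ.- b) ≈ 1#
  ω^-≈⇒ω^[-]≈1 a b ωᵃ≈ωᵇ = begin
    ω^ (a ℤ.- b)                 ≈⟨ ω^-+ a (ℤ.- b) ⟩
    ω^ a * ω^ (ℤ.- b)            ≈⟨ *-congʳ ωᵃ≈ωᵇ ⟩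
    ω^ b * ω^ (ℤ.- b)            ≈⟨ sym (ω^-+ b (ℤ.- b)) ⟩
    ω^ (b ℤ.- b)                 ≈⟨ ω^-≡ (ℤP.+-inverseʳ b) ⟩
    ω^ (+ 0)                     ≈⟨ ω^-pos 0 ⟩
    1#                           ∎

  ωpow≈ω^ : ∀ z → ωpow z ≈ ω^ z
  ωpow≈ω^ (+ n)        = sym (ω^-pos n)
  ωpow≈ω^ ℤ.-[1+ n ]  = begin
    pow (pow ω (x ℕ.∸ 1)) (suc n)   ≈⟨ sym (pow-* ω (x ℕ.∸ 1) (suc n)) ⟩
    pow ω ((x ℕ.∸ 1) ℕ.* suc n)     ≈⟨ sym (ω^-reduce ℤ.-[1+ n ] _ (ℤ.- + suc n) -[1+n]≡) ⟩
    ω^ ℤ.-[1+ n ]                    ∎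
    where
      -- ωpow reads ω⁻¹ as ωˣ⁻¹, so ω^(-(n+1)) = ω^((x-1)(n+1)) · (ωˣ)^(-(n+1)).
      split : ∀ Y B → ℤ.- B ≡ Y ℤ.* B ℤ.+ (+ 1 ℤ.+ Y) ℤ.* (ℤ.- B)
      split = solve-∀
      x≡1+[x-1] : + x ≡ + 1 ℤ.+ + (x ℕ.∸ 1)
      x≡1+[x-1] = P.trans (P.cong +_ (P.sym (ℕP.m+[n∸m]≡n (ℕ.>-nonZero⁻¹ x)))) (ℤP.pos-+ 1 (x ℕ.∸ 1))
      -[1+n]≡ : ℤ.-[1+ n ] ≡ + ((x ℕ.∸ 1) ℕ.* suc n) ℤ.+ + x ℤ.* (ℤ.- + suc n)
      -[1+n]≡ = P.trans (split (+ (x ℕ.∸ 1)) (+ suc n))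
        (P.cong₂ (λ a X → a ℤ.+ X ℤ.* (ℤ.- + suc n)) (P.sym (ℤP.pos-* (x ℕ.∸ 1) (suc n))) (P.sym x≡1+[x-1]))

  -- x′ j is a period of n ↦ ωʲⁿ, which is why v_j is made of blocks of length x′ j.
  pow-ωʲ-x′ : ∀ j → pow (pow ω j) (x′ j) ≈ 1#
  pow-ωʲ-x′ j = begin
    pow (pow ω j) (x′ j)         ≡⟨ P.cong (pow (pow ω j)) (divN≡/ x g) ⟩
    pow (pow ω j) (x / g)        ≈⟨ sym (pow-* ω j (x / g)) ⟩
    pow ω (j ℕ.* (x / g))        ≡⟨ P.cong (pow ω) (m[n/gcd]≡n[m/gcd] j x) ⟩
    pow ω (x ℕ.* (j / g))        ≈⟨ pow-*≈1# ω x (j / g) ωˣ≈1 ⟩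
    1#                           ∎
    where
      g = gcd j x
      instance
        _ : ℕ.NonZero g
        _ = ℕ.≢-nonZero (gcd[m,n]≢0 j x (inj₂ (ℕ.≢-nonZero⁻¹ x)))

  vvec-suc : ∀ j n → vvec j (suc n) ≈ pow (pow ω j) n
  vvec-suc j n = pow-modN (pow ω j) (x′ j) n (pow-ωʲ-x′ j)

  vvec≈ω^ : ∀ j n → vvec j (suc n) ≈ ω^ (+ j ℤ.* + suc n ℤ.- + j)
  vvec≈ω^ j n = begin
    vvec j (suc n)               ≈⟨ vvec-suc j n ⟩
    pow (pow ω j) n              ≈⟨ sym (pow-* ω j n) ⟩
    pow ω (j ℕ.* n)              ≈⟨ sym (ω^-pos (j ℕ.* n)) ⟩
    ω^ (+ (j ℕ.* n))             ≈⟨ ω^-≡ (P.trans (ℤP.pos-* j n) (P.trans (unshift (+ j) (+ n))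
                                      (P.cong (λ m → + j ℤ.* m ℤ.- + j) (P.sym (ℤP.pos-+ 1 n))))) ⟩
    ω^ (+ j ℤ.* + suc n ℤ.- + j) ∎
    where
      unshift : ∀ J N → J ℤ.* N ≡ J ℤ.* (+ 1 ℤ.+ N) ℤ.- J
      unshift = solve-∀

  -- Left eigenvectors of X: Σₘ dual j m X_{mn} = λ_j dual j n.
  dual : ℕ → ℕ → Carrier
  dual j n = ω^ (ℤ.- (+ j ℤ.* + n))

  dual≈pow : ∀ j n → dual j n ≈ pow (ω^ (ℤ.- + n)) j
  dual≈pow j n = sym (trans (pow-ω^ (ℤ.- + n) j) (ω^-≡ (neg-comm (+ n) (+ j))))
    where
      neg-comm : ∀ N J → ℤ.- N ℤ.* J ≡ ℤ.- (J ℤ.* N)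
      neg-comm = solve-∀

  module Primitive
    (zero-product : ∀ a b → a * b ≈ 0# → a ≈ 0# ⊎ b ≈ 0#)
    (ω-primitive : ∀ d → 1 ≤ d → d < x → ¬ (pow ω d ≈ 1#)) where
    open IntegralDomain zero-product

    ω^[j-a]≉1-< : ∀ {a j} → 1 ≤ a → a < j → j ≤ x → ¬ (ω^ (+ j ℤ.- + a) ≈ 1#)
    ω^[j-a]≉1-< {a} 1≤a a<j j≤x with ℕP.m≤n⇒∃[o]m+o≡n (ℕP.<⇒≤ a<j)
    ... | d , P.refl = λ ω^d≈1 → ω-primitive d 1≤d d<x (begin
      pow ω d                      ≈⟨ sym (ω^-pos d) ⟩
      ω^ (+ d)                     ≈⟨ ω^-≡ (P.sym (P.trans (P.cong (ℤ._- + a) (ℤP.pos-+ a d)) (cancel (+ a) (+ d)))) ⟩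
      ω^ (+ (a ℕ.+ d) ℤ.- + a)     ≈⟨ ω^d≈1 ⟩
      1#                           ∎)
      where
        cancel : ∀ A D → (A ℤ.+ D) ℤ.- A ≡ D
        cancel = solve-∀
        1≤d : 1 ≤ d
        1≤d = ℕP.+-cancelˡ-< a 0 d (P.subst (ℕ._< a ℕ.+ d) (P.sym (ℕP.+-identityʳ a)) a<j)
        d<x : d < x
        d<x = ℕP.<-≤-trans (ℕP.m<n+m d 1≤a) j≤x

    ω^[j-a]≉1 : ∀ {a j} → 1 ≤ a → a ≤ x → 1 ≤ j → j ≤ x → a ≢ j → ¬ (ω^ (+ j ℤ.- + a) ≈ 1#)
    ω^[j-a]≉1 {a} {j} 1≤a a≤x 1≤j j≤x a≢j with ℕP.<-cmp a j
    ... | tri< a<j _ _ = ω^[j-a]≉1-< 1≤a a<j j≤x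
    ... | tri≈ _ a≡j _ = ⊥-elim (a≢j a≡j)
    ... | tri> _ _ j<a = λ ω^[j-a]≈1 → ω^[j-a]≉1-< 1≤j j<a a≤x (begin
      ω^ (+ a ℤ.- + j)             ≈⟨ ω^-≡ (flip (+ a) (+ j)) ⟩
      ω^ (+ 0 ℤ.- (+ j ℤ.- + a))   ≈⟨ ω^-≈⇒ω^[-]≈1 (+ 0) (+ j ℤ.- + a) (trans (ω^-pos 0) (sym ω^[j-a]≈1)) ⟩
      1#                           ∎)
      where
        flip : ∀ A J → A ℤ.- J ≡ + 0 ℤ.- (J ℤ.- A)
        flip = solve-∀

    ω^-distinct : ∀ {t s} → 1 ≤ t → t ≤ x → 1 ≤ s → s ≤ x → t ≢ s → ¬ (ω^ (+ t) ≈ ω^ (+ s))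
    ω^-distinct {t} {s} 1≤t t≤x 1≤s s≤x t≢s ωᵗ≈ωˢ =
      ω^[j-a]≉1 1≤s s≤x 1≤t t≤x (λ s≡t → t≢s (P.sym s≡t)) (ω^-≈⇒ω^[-]≈1 (+ t) (+ s) ωᵗ≈ωˢ)

    ω^-neg-distinct : ∀ {t s} → 1 ≤ t → t ≤ x → 1 ≤ s → s ≤ x → t ≢ s →
                      ¬ (ω^ (ℤ.- + t) ≈ ω^ (ℤ.- + s))
    ω^-neg-distinct {t} {s} 1≤t t≤x 1≤s s≤x t≢s ω⁻ᵗ≈ω⁻ˢ = ω^[j-a]≉1 1≤t t≤x 1≤s s≤x t≢s
      (trans (ω^-≡ (swap (+ s) (+ t))) (ω^-≈⇒ω^[-]≈1 (ℤ.- + t) (ℤ.- + s) ω⁻ᵗ≈ω⁻ˢ))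
      where
        swap : ∀ S T → S ℤ.- T ≡ ℤ.- T ℤ.- ℤ.- S
        swap = solve-∀

    orthogonality : ∀ a j c → 1 ≤ a → a ≤ x → 1 ≤ j → j ≤ x →
      sum1 x (λ n → ω^ (c ℤ.+ (+ j ℤ.- + a) ℤ.* + n)) ≈ δ a j (nat x * ω^ c)
    orthogonality a j c 1≤a a≤x 1≤j j≤x with a ℕ.≟ j
    ... | yes P.refl = begin
      sum1 x (λ n → ω^ (c ℤ.+ (+ a ℤ.- + a) ℤ.* + n))  ≈⟨ sum1-cong x (λ n _ → ω^-≡ (vanish c (+ a) (+ suc n))) ⟩
      sum1 x (λ _ → ω^ c)                              ≈⟨ sum1-const x (ω^ c) ⟩
      nat x * ω^ c                                     ≈⟨ sym (δ-on {a} {a} P.refl) ⟩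
      δ a a (nat x * ω^ c)                             ∎
      where
        vanish : ∀ c A N → c ℤ.+ (A ℤ.- A) ℤ.* N ≡ c
        vanish = solve-∀
    ... | no a≢j = begin
      sum1 x (λ n → ω^ (c ℤ.+ d ℤ.* + n))   ≈⟨ sum1-cong x (λ n _ →
                                                 trans (ω^-+ c _) (*-congˡ (sym (pow-ω^ d (suc n))))) ⟩
      sum1 x (λ n → ω^ c * pow (ω^ d) n)    ≈⟨ sym (sum1-*ˡ x (ω^ c) (pow (ω^ d))) ⟩
      ω^ c * sum1 x (pow (ω^ d))            ≈⟨ *-congˡ (sum1-pow≈0# (ω^ d) x (pow-ω^-x d)
                                                 (ω^[j-a]≉1 1≤a a≤x 1≤j j≤x a≢j)) ⟩
      ω^ c * 0#                             ≈⟨ zeroʳ _ ⟩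
      0#                                    ≈⟨ sym (δ-off a≢j) ⟩
      δ a j (nat x * ω^ c)                  ∎
      where d = + j ℤ.- + a

module RamanujanMatrix {c ℓ : Level} (R : CommutativeRing c ℓ) (ω : CommutativeRing.Carrier R) (Q : ℕ) where
  open CommutativeRing R
  x : ℕ
  x = lcmUpTo Q
  instance
    _ : ℕ.NonZero x
    _ = ℕ.≢-nonZero (lcmUpTo≢0 Q)
  open Ramanujan R ω x
  open SumsAndPowers R ω x
  open ReducedFractions x
  open import Relation.Binary.Reasoning.Setoid setoid

  -- By definition, Xmat Q m n = Σ-reduced Q (λ q k → ωpow (phase q k m n)).
  phase : ℕ → ℕ → ℕ → ℕ → ℤ
  phase q k m n = + (divN x q ℕ.* k) ℤ.* (+ m ℤ.- + n)

  -- k / q ↦ (x / q) k is a bijection from the reduced fractions with q ≤ Q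
  -- onto the j ∈ [1, x] with x′ j ≤ Q.
  Σ-reduced-δ : ∀ j u → 1 ≤ j → j ≤ x →
    Σ-reduced Q (λ q k → δ (divN x q ℕ.* k) j u) ≈ (if does (x′ j ℕ.≤? Q) then u else 0#)
  Σ-reduced-δ j u 1≤j j≤x =
    sym (if-does (x′ j ℕ.≤? Q) (λ x′≤Q → sym (hit x′≤Q)) (λ x′≰Q → sym (miss x′≰Q)))
    where
      open ReducedForm (reduced-form 1≤j j≤x)
      term : ℕ → ℕ → Carrier
      term q k = if does (gcd k q ℕ.≟ 1) then δ (divN x q ℕ.* k) j u else 0#
      term≈0 : ∀ q k → 1 ≤ q → q ≤ Q → q ≢ x′ j ⊎ k ≢ num j → term q k ≈ 0#
      term≈0 q k 1≤q q≤Q off = if-does (gcd k q ℕ.≟ 1) (λ coprime[k,q] → δ-off (λ [x/q]k≡j →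
          let (q≡x′ , k≡num) = reduced-unique 1≤q (∣lcmUpTo Q 1≤q q≤Q) coprime[k,q] [x/q]k≡j
          in [ (λ q≢x′ → q≢x′ q≡x′) , (λ k≢num → k≢num k≡num) ] off))
        (λ _ → refl)
      hit : x′ j ≤ Q → Σ-reduced Q (λ q k → δ (divN x q ℕ.* k) j u) ≈ u
      hit x′≤Q = begin
        sum1 Q (λ q → sum1 q (term q))   ≈⟨ sum1-single Q (x′ j) _ 1≤den x′≤Q (λ q q<Q q≢x′ → sum1≈0# (suc q)
                                              (λ k _ → term≈0 (suc q) (suc k) (s≤s z≤n) q<Q (inj₁ q≢x′))) ⟩
        sum1 (x′ j) (term (x′ j))        ≈⟨ sum1-single (x′ j) (num j) _ 1≤num num≤den (λ k _ k≢num →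
                                              term≈0 (x′ j) (suc k) 1≤den x′≤Q (inj₂ k≢num)) ⟩
        term (x′ j) (num j)              ≈⟨ if-does (gcd (num j) (x′ j) ℕ.≟ 1) (λ _ → δ-on divN-*)
                                              (λ ¬coprime → ⊥-elim (¬coprime coprime)) ⟩
        u                                ∎
      miss : ¬ (x′ j ≤ Q) → Σ-reduced Q (λ q k → δ (divN x q ℕ.* k) j u) ≈ 0#
      miss x′≰Q = sum1≈0# Q (λ q q<Q → sum1≈0# (suc q) (λ k _ →
        term≈0 (suc q) (suc k) (s≤s z≤n) q<Q (inj₁ (λ q≡x′ → x′≰Q (P.subst (_≤ Q) q≡x′ q<Q)))))

  Σ-reduced-eigλ : ∀ j u (G : ℕ → ℕ → Carrier) → 1 ≤ j → j ≤ x →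
    (∀ q k → 1 ≤ q → q ≤ Q → 1 ≤ k → k ≤ q → G q k ≈ δ (divN x q ℕ.* k) j (nat x * u)) →
    Σ-reduced Q G ≈ eigλ Q j * u
  Σ-reduced-eigλ j u G 1≤j j≤x G≈δ = begin
    Σ-reduced Q G                                              ≈⟨ Σ-reduced-cong Q G≈δ ⟩
    Σ-reduced Q (λ q k → δ (divN x q ℕ.* k) j (nat x * u))     ≈⟨ Σ-reduced-δ j _ 1≤j j≤x ⟩
    (if does (x′ j ℕ.≤? Q) then nat x * u else 0#)             ≈⟨ sym (if-*ʳ (does (x′ j ℕ.≤? Q)) (nat x) u) ⟩
    eigλ Q j * u                                               ∎

  module Spectrum (ωˣ≈1 : pow ω x ≈ 1#) (1≉0 : ¬ (1# ≈ 0#))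
           (zero-product : ∀ a b → a * b ≈ 0# → a ≈ 0# ⊎ b ≈ 0#)
           (ω-primitive : ∀ d → 1 ≤ d → d < x → ¬ (pow ω d ≈ 1#)) where
    open RootOfUnity R ω x ωˣ≈1
    open Primitive zero-product ω-primitive
    open IntegralDomain zero-product
    open import Algebra.Properties.CommutativeSemigroup *-commutativeSemigroup using (x∙yz≈y∙xz)

    phase-bounds : ∀ q k → 1 ≤ q → q ≤ Q → 1 ≤ k → k ≤ q → 1 ≤ divN x q ℕ.* k × divN x q ℕ.* k ≤ x
    phase-bounds q k 1≤q q≤Q = divN-*-bounds 1≤q (∣lcmUpTo Q 1≤q q≤Q)

    vvec-character-sum : ∀ a j m → 1 ≤ a → a ≤ x → 1 ≤ j → j ≤ x →
      sum1 x (λ n → ωpow (+ a ℤ.* (+ suc m ℤ.- + n)) * vvec j n) ≈ δ a j (nat x * vvec j (suc m))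
    vvec-character-sum a j m 1≤a a≤x 1≤j j≤x = begin
      sum1 x (λ n → ωpow (+ a ℤ.* (+ suc m ℤ.- + n)) * vvec j n)  ≈⟨ sum1-cong x (λ n _ → term n) ⟩
      sum1 x (λ n → ω^ (c₀ ℤ.+ (+ j ℤ.- + a) ℤ.* + n))             ≈⟨ orthogonality a j c₀ 1≤a a≤x 1≤j j≤x ⟩
      δ a j (nat x * ω^ c₀)                                          ≈⟨ δ-cong a j (λ { P.refl →
                                                                          *-congˡ (sym (vvec≈ω^ a m)) }) ⟩
      δ a j (nat x * vvec j (suc m))                                ∎
      where
        c₀ = + a ℤ.* + suc m ℤ.- + j
        regroup : ∀ A J M N → A ℤ.* (M ℤ.- N) ℤ.+ (J ℤ.* N ℤ.- J) ≡ (A ℤ.* M ℤ.- J) ℤ.+ (J ℤ.- A) ℤ.* N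
        regroup = solve-∀
        term : ∀ n → ωpow (+ a ℤ.* (+ suc m ℤ.- + suc n)) * vvec j (suc n) ≈ ω^ (c₀ ℤ.+ (+ j ℤ.- + a) ℤ.* + suc n)
        term n = trans (*-cong (ωpow≈ω^ (+ a ℤ.* (+ suc m ℤ.- + suc n))) (vvec≈ω^ j n))
          (trans (sym (ω^-+ (+ a ℤ.* (+ suc m ℤ.- + suc n)) _))
                 (ω^-≡ (regroup (+ a) (+ j) (+ suc m) (+ suc n))))

    dual-character-sum : ∀ a j n → 1 ≤ a → a ≤ x → 1 ≤ j → j ≤ x →
      sum1 x (λ m → dual j m * ωpow (+ a ℤ.* (+ m ℤ.- + n))) ≈ δ a j (nat x * dual j n)
    dual-character-sum a j n 1≤a a≤x 1≤j j≤x = begin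
      sum1 x (λ m → dual j m * ωpow (+ a ℤ.* (+ m ℤ.- + n)))  ≈⟨ sum1-cong x (λ m _ → term m) ⟩
      sum1 x (λ m → ω^ (c₀ ℤ.+ (+ a ℤ.- + j) ℤ.* + m))         ≈⟨ orthogonality j a c₀ 1≤j j≤x 1≤a a≤x ⟩
      δ j a (nat x * ω^ c₀)                                      ≈⟨ δ-sym a j ⟩
      δ a j (nat x * dual a n)                                  ≈⟨ δ-cong a j (λ { P.refl → refl }) ⟩
      δ a j (nat x * dual j n)                                  ∎
      where
        c₀ = ℤ.- (+ a ℤ.* + n)
        regroup : ∀ A J M N → ℤ.- (J ℤ.* M) ℤ.+ A ℤ.* (M ℤ.- N) ≡ ℤ.- (A ℤ.* N) ℤ.+ (A ℤ.- J) ℤ.* M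
        regroup = solve-∀
        term : ∀ m → dual j (suc m) * ωpow (+ a ℤ.* (+ suc m ℤ.- + n)) ≈ ω^ (c₀ ℤ.+ (+ a ℤ.- + j) ℤ.* + suc m)
        term m = trans (*-congˡ (ωpow≈ω^ (+ a ℤ.* (+ suc m ℤ.- + n))))
          (trans (sym (ω^-+ (ℤ.- (+ j ℤ.* + suc m)) (+ a ℤ.* (+ suc m ℤ.- + n))))
                 (ω^-≡ (regroup (+ a) (+ j) (+ suc m) (+ n))))

    X-vvec : ∀ j m → 1 ≤ j → j ≤ x → Xapply Q (vvec j) (suc m) ≈ eigλ Q j * vvec j (suc m)
    X-vvec j m 1≤j j≤x = begin
      sum1 x (λ n → Xmat Q (suc m) n * vvec j n)
        ≈⟨ sum1-cong x (λ n _ → Σ-reduced-* Q (vvec j (suc n)) (λ q k → ωpow (phase q k (suc m) (suc n)))) ⟩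
      sum1 x (λ n → Σ-reduced Q (λ q k → ωpow (phase q k (suc m) n) * vvec j n))
        ≈⟨ sum1-Σ-reduced x Q _ ⟩
      Σ-reduced Q (λ q k → sum1 x (λ n → ωpow (phase q k (suc m) n) * vvec j n))
        ≈⟨ Σ-reduced-eigλ j (vvec j (suc m)) _ 1≤j j≤x (λ q k 1≤q q≤Q 1≤k k≤q →
             let (1≤a , a≤x) = phase-bounds q k 1≤q q≤Q 1≤k k≤q
             in vvec-character-sum (divN x q ℕ.* k) j m 1≤a a≤x 1≤j j≤x) ⟩
      eigλ Q j * vvec j (suc m) ∎

    dual-X : ∀ j n → 1 ≤ j → j ≤ x → sum1 x (λ m → dual j m * Xmat Q m n) ≈ eigλ Q j * dual j n
    dual-X j n 1≤j j≤x = begin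
      sum1 x (λ m → dual j m * Xmat Q m n)
        ≈⟨ sum1-cong x (λ m _ → *-Σ-reduced Q (dual j (suc m)) (λ q k → ωpow (phase q k (suc m) n))) ⟩
      sum1 x (λ m → Σ-reduced Q (λ q k → dual j m * ωpow (phase q k m n)))
        ≈⟨ sum1-Σ-reduced x Q _ ⟩
      Σ-reduced Q (λ q k → sum1 x (λ m → dual j m * ωpow (phase q k m n)))
        ≈⟨ Σ-reduced-eigλ j (dual j n) _ 1≤j j≤x (λ q k 1≤q q≤Q 1≤k k≤q →
             let (1≤a , a≤x) = phase-bounds q k 1≤q q≤Q 1≤k k≤q
             in dual-character-sum (divN x q ℕ.* k) j n 1≤a a≤x 1≤j j≤x) ⟩
      eigλ Q j * dual j n ∎

    eigenpair : ∀ j → 1 ≤ j → j ≤ x → IsEigenpair Q (eigλ Q j) (vvec j)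
    eigenpair j 1≤j j≤x = eigen , (1 , ℕP.≤-refl , ℕ.>-nonZero⁻¹ x , v₁≉0)
      where
        eigen : ∀ m → 1 ≤ m → m ≤ x → Xapply Q (vvec j) m ≈ eigλ Q j * vvec j m
        eigen (suc m) _ _ = X-vvec j m 1≤j j≤x
        v₁≉0 : ¬ (vvec j 1 ≈ 0#)
        v₁≉0 v₁≈0 = 1≉0 (trans (sym (vvec-suc j 0)) v₁≈0)

    dual-transform : (ℕ → Carrier) → ℕ → Carrier
    dual-transform v j = sum1 x (λ n → dual j n * v n)

    dual-transform-eigen : ∀ μ v → (∀ m → 1 ≤ m → m ≤ x → Xapply Q v m ≈ μ * v m) →
      ∀ j → 1 ≤ j → j ≤ x → μ * dual-transform v j ≈ eigλ Q j * dual-transform v j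
    dual-transform-eigen μ v Xv≈μv j 1≤j j≤x = begin
      μ * sum1 x (λ m → dual j m * v m)
        ≈⟨ sum1-*ˡ x μ _ ⟩
      sum1 x (λ m → μ * (dual j m * v m))
        ≈⟨ sum1-cong x (λ m m<x → trans (x∙yz≈y∙xz μ _ _) (*-congˡ (sym (Xv≈μv (suc m) (s≤s z≤n) m<x)))) ⟩
      sum1 x (λ m → dual j m * Xapply Q v m)
        ≈⟨ sum1-cong x (λ m _ → sum1-*ˡ x (dual j (suc m)) _) ⟩
      sum1 x (λ m → sum1 x (λ n → dual j m * (Xmat Q m n * v n)))
        ≈⟨ sum1-swap x x _ ⟩
      sum1 x (λ n → sum1 x (λ m → dual j m * (Xmat Q m n * v n)))
        ≈⟨ sum1-cong x (λ n _ → trans (sum1-cong x (λ m _ → sym (*-assoc _ _ _))) (sym (sum1-*ʳ x (v (suc n)) _))) ⟩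
      sum1 x (λ n → sum1 x (λ m → dual j m * Xmat Q m n) * v n)
        ≈⟨ sum1-cong x (λ n _ → trans (*-congʳ (dual-X j (suc n) 1≤j j≤x)) (*-assoc _ _ _)) ⟩
      sum1 x (λ n → eigλ Q j * (dual j n * v n))
        ≈⟨ sym (sum1-*ˡ x (eigλ Q j) _) ⟩
      eigλ Q j * sum1 x (λ n → dual j n * v n)
        ∎

    dual-transform-injective : ∀ v → (∀ j → 1 ≤ j → j ≤ x → dual-transform v j ≈ 0#) →
      ∀ n → 1 ≤ n → n ≤ x → v n ≈ 0#
    dual-transform-injective v transform≈0 =
      vandermonde x x v node ℕP.≤-refl (λ t s 1≤t t≤x 1≤s s≤x → ω^-neg-distinct 1≤t t≤x 1≤s s≤x) power-sums≈0
      where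
        node : ℕ → Carrier
        node t = ω^ (ℤ.- + t)
        power-sum≈transform : ∀ i → sum1 x (λ t → v t * pow (node t) i) ≈ dual-transform v i
        power-sum≈transform i = sum1-cong x (λ t _ → trans (*-comm _ _) (*-congʳ (sym (dual≈pow i (suc t)))))
        power-sums≈0 : ∀ i → i < x → sum1 x (λ t → v t * pow (node t) i) ≈ 0#
        power-sums≈0 zero    _   = trans (sum1-cong x (λ t _ → *-congˡ (sym (pow-ω^-x (ℤ.- + suc t)))))
                                         (trans (power-sum≈transform x) (transform≈0 x (ℕ.>-nonZero⁻¹ x) ℕP.≤-refl))
        power-sums≈0 (suc i) i<x = trans (power-sum≈transform (suc i)) (transform≈0 (suc i) (s≤s z≤n) (ℕP.<⇒≤ i<x))

    -- ⟨dual j, v⟩ (μ − λ_j) = 0 for every j, and not all ⟨dual j, v⟩ vanish.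
    eigenvalue : ∀ μ v → IsEigenpair Q μ v → ∃ (λ j → 1 ≤ j × j ≤ x × μ ≈ eigλ Q j)
    eigenvalue μ v (Xv≈μv , n , 1≤n , n≤x , vₙ≉0)
      with some-or-all x (λ j 1≤j j≤x → *-cancelʳ-⊎ μ (eigλ Q j) _ (dual-transform-eigen μ v Xv≈μv j 1≤j j≤x))
    ... | inj₁ μ≈λⱼ       = μ≈λⱼ
    ... | inj₂ transform≈0 = ⊥-elim (vₙ≉0 (dual-transform-injective v transform≈0 n 1≤n n≤x))

    vvec-independent : ∀ (a : ℕ → Carrier) → (∀ n → 1 ≤ n → n ≤ x → sum1 x (λ j → a j * vvec j n) ≈ 0#) →
      ∀ j → 1 ≤ j → j ≤ x → a j ≈ 0#
    vvec-independent a combination≈0 = vandermonde x x a (pow ω) ℕP.≤-refl distinct power-sums≈0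
      where
        distinct : ∀ t s → 1 ≤ t → t ≤ x → 1 ≤ s → s ≤ x → t ≢ s → ¬ (pow ω t ≈ pow ω s)
        distinct t s 1≤t t≤x 1≤s s≤x t≢s ωᵗ≈ωˢ =
          ω^-distinct 1≤t t≤x 1≤s s≤x t≢s (trans (ω^-pos t) (trans ωᵗ≈ωˢ (sym (ω^-pos s))))
        power-sums≈0 : ∀ i → i < x → sum1 x (λ t → a t * pow (pow ω t) i) ≈ 0#
        power-sums≈0 i i<x = trans (sum1-cong x (λ t _ → *-congˡ (sym (vvec-suc (suc t) i))))
                                   (combination≈0 (suc i) (s≤s z≤n) i<x)

corollary2 : {c ℓ : Level} (R : CommutativeRing c ℓ) (ω : CommutativeRing.Carrier R) (Q : ℕ) →
    let open CommutativeRing R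
        x = lcmUpTo Q
        open Ramanujan R ω x
    in 1 ≤ Q →
       ¬ (1# ≈ 0#) →
       (∀ a b → a * b ≈ 0# → a ≈ 0# ⊎ b ≈ 0#) →
       pow ω x ≈ 1# →
       (∀ d → 1 ≤ d → d < x → ¬ (pow ω d ≈ 1#)) →
       ((j : ℕ) → 1 ≤ j → j ≤ x → IsEigenpair Q (eigλ Q j) (vvec j))
       × ((μ : Carrier) (v : ℕ → Carrier) → IsEigenpair Q μ v →
            ∃ (λ j → 1 ≤ j × j ≤ x × μ ≈ eigλ Q j))
       × ((a : ℕ → Carrier) →
            ((n : ℕ) → 1 ≤ n → n ≤ x → sum1 x (λ j → a j * vvec j n) ≈ 0#) →
            (j : ℕ) → 1 ≤ j → j ≤ x → a j ≈ 0#)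
corollary2 R ω Q _ 1≉0 zero-product ωˣ≈1 ω-primitive = eigenpair , eigenvalue , vvec-independent
  where open RamanujanMatrix.Spectrum R ω Q ωˣ≈1 1≉0 zero-product ω-primitive
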